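{- Let $p,q$ be positive integers. For every positive integer $k$ there exists an integer $N=N(p,q,k)$ such that for every hypergraph $\mathcal F$ on a finite vertex set $X$ the following holds: if $\mathcal F$ contains a matching $\mathcal M\subseteq \mathcal F$ (a family of pairwise disjoint edges) with $|\mathcal M|=N$ and $\frac{1}{N}\sum_{F\in \mathcal M}|F|\leq k$, then Enforcer has a winning strategy in the $(p,q)$ Avoider-Enforcer game $\mathcal F$ played according to the monotone rules, both as the first and as the second player.
   Context: In a $(p,q)$ Avoider-Enforcer game $\mathcal F$ on a finite board $X$ (the edges of the hypergraph $\mathcal F\subseteq 2^X$ being the target sets) played according to the monotone rules, Avoider and Enforcer alternately claim at least $p$ and at least $q$ previously unclaimed elements of $X$ per move, respectively; if fewer than $p$ (resp. $q$) unclaimed elements remain before Avoider's (resp. Enforcer's) move, he claims all of them. It is specified which player moves first. The game ends when all elements are claimed; Avoider loses (Enforcer wins) if at the end Avoider has claimed all elements of some $F\in\mathcal F$, otherwise Avoider wins. -}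

module Defs where

open import Data.Nat using (ℕ; _≤_; _<_; _*_)
open import Data.Fin.Subset using (Subset; _⊆_; _∪_; _∩_; ∁; ∣_∣; Empty; Nonempty)
open import Data.List using (List; length; map)
open import Data.Nat.ListAction using (sum)
open import Data.List.Membership.Propositional using (_∈_)
open import Data.List.Relation.Unary.All using (All)
open import Data.List.Relation.Unary.AllPairs using (AllPairs)
open import Data.List.Relation.Unary.Unique.Propositional using (Unique)
open import Data.Product using (Σ; _×_)
open import Data.Sum using (_⊎_)
open import Relation.Binary.PropositionalEquality using (_≡_)

data Player : Set where
  avoider enforcer : Player

Hypergraph : ℕ → Set
Hypergraph n = List (Subset n)

Unclaimed : ∀ {n} → Subset n → Subset n → Subset n
Unclaimed A E = ∁ (A ∪ E)

LegalMove : ∀ {n} → ℕ → Subset n → Subset n → Set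
LegalMove r U S = S ⊆ U × ((r ≤ ∣ U ∣ × r ≤ ∣ S ∣) ⊎ (∣ U ∣ < r × S ≡ U))

AvoiderLoses : ∀ {n} → Hypergraph n → Subset n → Set
AvoiderLoses 𝓕 A = Σ _ λ F → F ∈ 𝓕 × F ⊆ A

-- EnforcerWins p q 𝓕 t A E : in the (p,q) monotone Avoider-Enforcer game 𝓕,
-- from the position where Avoider has claimed A, Enforcer has claimed E and
-- player t is to move, Enforcer has a winning strategy.  (Least fixed point:
-- the board is finite and every move claims ≥ 1 element, so this is exactly
-- the existence of a winning strategy.)
data EnforcerWins {n : ℕ} (p q : ℕ) (𝓕 : Hypergraph n)
       : Player → Subset n → Subset n → Set where
  gameOver : ∀ {t A E} → Empty (Unclaimed A E) → AvoiderLoses 𝓕 A →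
             EnforcerWins p q 𝓕 t A E
  enfMove  : ∀ {A E} (S : Subset n) → Nonempty (Unclaimed A E) →
             LegalMove q (Unclaimed A E) S →
             EnforcerWins p q 𝓕 avoider A (E ∪ S) →
             EnforcerWins p q 𝓕 enforcer A E
  avMove   : ∀ {A E} → Nonempty (Unclaimed A E) →
             (∀ (S : Subset n) → LegalMove p (Unclaimed A E) S →
                EnforcerWins p q 𝓕 enforcer (A ∪ S) E) →
             EnforcerWins p q 𝓕 avoider A E

∅ₛ : ∀ {n} → Subset n
∅ₛ = Data.Fin.Subset.⊥

Disjoint : ∀ {n} → Subset n → Subset n → Set
Disjoint S T = Empty (S ∩ T)

IsMatching : ∀ {n} → Hypergraph n → List (Subset n) → Set
IsMatching 𝓕 M = All (_∈ 𝓕) M × Unique M × AllPairs Disjoint M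

totalSize : ∀ {n} → List (Subset n) → ℕ
totalSize M = sum (map ∣_∣ M)

module Submission where

-- Enforcer's strategy ("trimming"): he keeps a family K ⊑ M of edges that he
-- has not touched, of size q·m + 1 in round m, such that every unclaimed
-- element lies in ⋃ K when Avoider is to move.  On his turn he drops the q
-- edges of K containing the most unclaimed elements and claims every
-- unclaimed element outside the remaining edges (at least q of them, since
-- each dropped edge still meets the unclaimed set).  Avoider must then claim
-- p elements inside ⋃ K, so the average number of unclaimed elements per
-- edge of K drops by about p/|K| each round, while trimming never raises
-- that average.  Measured against a budget C/Q, round m costs
-- d m ≈ p·Q/(q·m + 1), and the harmonic series makes the total cost exceed
-- the initial average k; so at some point an edge of K has no unclaimed
-- element left although Enforcer never touched it, i.e. Avoider owns it.

open import Defs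
open import Data.Nat using (ℕ; _≤_; _<_; _*_)
open import Data.List using (List; length)
open import Data.Fin.Subset using (Subset)
open import Data.Product using (Σ; _×_)
open import Relation.Binary.PropositionalEquality using (_≡_)

open import Data.Empty using (⊥-elim)
open import Data.Fin using (Fin)
import Data.Vec as Vec
open import Data.Fin.Subset
  using (_∈_; _∉_; _⊆_; _∩_; _∪_; ∁; ⋃; ∣_∣; Empty; Nonempty; inside; outside)
open import Data.Fin.Subset.Properties
open import Data.List using ([]; _∷_; map)
open import Data.List.Membership.Propositional using (find) renaming (_∈_ to _∈ₗ_)
open import Data.List.Relation.Binary.Sublist.Propositional
  using ([]; _∷_; _∷ʳ_)
  renaming (_⊆_ to _⊑_; ⊆-refl to ⊑-refl; ⊆-trans to ⊑-trans)
open import Data.List.Relation.Binary.Sublist.Propositional.Properties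
  using (All-resp-⊆; Any-resp-⊆)
open import Data.List.Relation.Unary.All as All using (All; []; _∷_; all?)
open import Data.List.Relation.Unary.All.Properties using (¬All⇒Any¬)
open import Data.List.Relation.Unary.AllPairs using (AllPairs; []; _∷_)
open import Data.List.Relation.Unary.Any using (here; there)
open import Data.Nat using (suc; zero; _+_; _∸_; _^_; _/_; z≤n; s≤s; >-nonZero; NonZero)
open import Data.Nat.DivMod using (m/n*n≤m; m*n/n≡m; /-monoˡ-≤; m≥n⇒m/n>0)
open import Data.Nat.ListAction using (sum)
open import Data.Nat.Properties
open import Algebra.Properties.CommutativeSemigroup +-commutativeSemigroup
  using (x∙yz≈y∙xz; xy∙z≈y∙xz)
open import Data.Product using (_,_; proj₁; proj₂)
open import Data.Sum using (_⊎_; inj₁; inj₂; [_,_])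
open import Relation.Binary.PropositionalEquality
  using (refl; sym; trans; cong; cong₂; subst; subst₂)
open import Relation.Nullary using (yes; no)
open import Data.Nat.Solver using (module +-*-Solver)

-- Removing an entry of maximal weight y from a list of b + 1 entries whose
-- other entries weigh r ≤ b·y does not raise the average above C/Q.
average-without-max : ∀ y r b Q C → r ≤ b * y → (y + r) * Q ≤ C * suc b → r * Q ≤ C * b
average-without-max y r b Q C r≤by avg = *-cancelʳ-≤ (r * Q) (C * b) (suc b) (begin
    r * Q * suc b       ≡⟨ *-assoc r Q (suc b) ⟩
    r * (Q * suc b)     ≡⟨ cong (r *_) (*-comm Q (suc b)) ⟩
    r * (suc b * Q)     ≡⟨ *-assoc r (suc b) Q ⟨
    r * suc b * Q       ≤⟨ *-monoˡ-≤ Q r·sb≤b·total ⟩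
    b * (y + r) * Q     ≡⟨ *-assoc b (y + r) Q ⟩
    b * ((y + r) * Q)   ≤⟨ *-monoʳ-≤ b avg ⟩
    b * (C * suc b)     ≡⟨ *-assoc b C (suc b) ⟨
    b * C * suc b       ≡⟨ cong (_* suc b) (*-comm b C) ⟩
    C * b * suc b       ∎)
  where
  open ≤-Reasoning
  r·sb≤b·total : r * suc b ≤ b * (y + r)
  r·sb≤b·total = begin
    r * suc b       ≡⟨ *-suc r b ⟩
    r + r * b       ≤⟨ +-monoˡ-≤ (r * b) r≤by ⟩
    b * y + r * b   ≡⟨ cong (b * y +_) (*-comm r b) ⟩
    b * y + b * r   ≡⟨ *-distribˡ-+ b y r ⟨
    b * (y + r)     ∎

-- Paying p units of trace against d units of budget per edge: if the trace
-- T is within budget C on b edges and d·b ≤ p·Q, then T - p is within C - d.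
pay : ∀ T Q C d p b → T * Q ≤ C * b → d * b ≤ p * Q → (T ∸ p) * Q ≤ (C ∸ d) * b
pay T Q C d p b avg cost = begin
  (T ∸ p) * Q      ≡⟨ *-distribʳ-∸ Q T p ⟩
  T * Q ∸ p * Q    ≤⟨ ∸-monoˡ-≤ (p * Q) avg ⟩
  C * b ∸ p * Q    ≤⟨ ∸-monoʳ-≤ (C * b) cost ⟩
  C * b ∸ d * b    ≡⟨ *-distribʳ-∸ b C d ⟨
  (C ∸ d) * b      ∎
  where open ≤-Reasoning

spend : ∀ {Q} C x y → 1 ≤ Q → C < Q + (x + y) → C ∸ x < Q + y
spend {Q} C x y Q≥1 C< =
  m<n+o⇒m∸n<o C x {{>-nonZero (≤-trans Q≥1 (m≤m+n Q y))}} (subst (C <_) (x∙yz≈y∙xz Q x y) C<)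

-- Weights of lists, and trimming a list by dropping its heaviest entries.

weight : ∀ {a} {X : Set a} → (X → ℕ) → List X → ℕ
weight w xs = sum (map w xs)

module _ {a} {X : Set a} where

  weight-mono : ∀ {v w : X → ℕ} (xs : List X) → All (λ x → v x ≤ w x) xs → weight v xs ≤ weight w xs
  weight-mono []       []         = z≤n
  weight-mono (x ∷ xs) (le ∷ les) = +-mono-≤ le (weight-mono xs les)

  AllPairs-⊑ : ∀ {r} {R : X → X → Set r} {xs ys : List X} → xs ⊑ ys → AllPairs R ys → AllPairs R xs
  AllPairs-⊑ []         []         = []
  AllPairs-⊑ (_ ∷ʳ s)   (_ ∷ rs)   = AllPairs-⊑ s rs
  AllPairs-⊑ (refl ∷ s) (r ∷ rs)   = All-resp-⊆ s r ∷ AllPairs-⊑ s rs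

  AverageAtMost : (X → ℕ) → ℕ → ℕ → List X → Set
  AverageAtMost w Q C xs = weight w xs * Q ≤ C * length xs

  module _ (w : X → ℕ) where

    length≤weight : ∀ (xs : List X) → All (λ x → 1 ≤ w x) xs → length xs ≤ weight w xs
    length≤weight []       []         = z≤n
    length≤weight (x ∷ xs) (pos ∷ ps) = +-mono-≤ pos (length≤weight xs ps)

    weight-⊑ : ∀ {ys xs : List X} → ys ⊑ xs → All (λ x → 1 ≤ w x) xs →
               weight w ys + length xs ≤ weight w xs + length ys
    weight-⊑ [] [] = z≤n
    weight-⊑ {ys} {y ∷ xs} (_ ∷ʳ s) (pos ∷ ps) = begin
      weight w ys + suc (length xs)   ≡⟨ +-suc (weight w ys) (length xs) ⟩
      suc (weight w ys + length xs)   ≤⟨ s≤s (weight-⊑ s ps) ⟩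
      suc (weight w xs + length ys)   ≤⟨ +-monoˡ-≤ (length ys) (+-monoˡ-≤ (weight w xs) pos) ⟩
      w y + weight w xs + length ys   ∎
      where open ≤-Reasoning
    weight-⊑ {x ∷ ys} {x ∷ xs} (refl ∷ s) (_ ∷ ps) = begin
      w x + weight w ys + suc (length xs)   ≡⟨ +-assoc (w x) _ _ ⟩
      w x + (weight w ys + suc (length xs)) ≡⟨ cong (w x +_) (+-suc _ _) ⟩
      w x + suc (weight w ys + length xs)   ≤⟨ +-monoʳ-≤ (w x) (s≤s (weight-⊑ s ps)) ⟩
      w x + suc (weight w xs + length ys)   ≡⟨ cong (w x +_) (+-suc _ _) ⟨
      w x + (weight w xs + suc (length ys)) ≡⟨ +-assoc (w x) _ _ ⟨
      w x + weight w xs + suc (length ys)   ∎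
      where open ≤-Reasoning

    dropped-weight : ∀ j {ys xs : List X} → ys ⊑ xs → All (λ x → 1 ≤ w x) xs →
                     length xs ≡ j + length ys → j + weight w ys ≤ weight w xs
    dropped-weight j {ys} {xs} ys⊑xs pos len = +-cancelʳ-≤ (length ys) _ _ (begin
      j + weight w ys + length ys   ≡⟨ xy∙z≈y∙xz j (weight w ys) (length ys) ⟩
      weight w ys + (j + length ys) ≡⟨ cong (weight w ys +_) len ⟨
      weight w ys + length xs       ≤⟨ weight-⊑ ys⊑xs pos ⟩
      weight w xs + length ys       ∎)
      where open ≤-Reasoning

    record HeaviestSplit (xs : List X) : Set a where
      field
        heaviest     : X
        rest         : List X
        rest⊑        : rest ⊑ xs
        length-rest  : suc (length rest) ≡ length xs
        weight-split : weight w xs ≡ w heaviest + weight w rest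
        rest-bounded : weight w rest ≤ length rest * w heaviest

    heaviestSplit : ∀ x xs → HeaviestSplit (x ∷ xs)
    heaviestSplit x [] = record
      { heaviest = x ; rest = [] ; rest⊑ = x ∷ʳ [] ; length-rest = refl
      ; weight-split = refl ; rest-bounded = z≤n }
    heaviestSplit x (y ∷ ys) with heaviestSplit y ys
    ... | R with w (HeaviestSplit.heaviest R) ≤? w x
    ...   | yes h≤x = record
      { heaviest = x ; rest = y ∷ ys ; rest⊑ = x ∷ʳ ⊑-refl ; length-rest = refl
      ; weight-split = refl ; rest-bounded = bounded }
      where
      open HeaviestSplit R
      bounded : weight w (y ∷ ys) ≤ length (y ∷ ys) * w x
      bounded = begin
        weight w (y ∷ ys)                   ≡⟨ weight-split ⟩
        w heaviest + weight w rest          ≤⟨ +-monoʳ-≤ (w heaviest) rest-bounded ⟩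
        suc (length rest) * w heaviest      ≡⟨ cong (_* w heaviest) length-rest ⟩
        length (y ∷ ys) * w heaviest        ≤⟨ *-monoʳ-≤ (length (y ∷ ys)) h≤x ⟩
        length (y ∷ ys) * w x               ∎
        where open ≤-Reasoning
    ...   | no h≰x = record
      { heaviest = heaviest ; rest = x ∷ rest ; rest⊑ = refl ∷ rest⊑
      ; length-rest = cong suc length-rest
      ; weight-split = trans (cong (w x +_) weight-split) (x∙yz≈y∙xz (w x) (w heaviest) (weight w rest))
      ; rest-bounded = +-mono-≤ (<⇒≤ (≰⇒> h≰x)) rest-bounded }
      where open HeaviestSplit R

    average-rest : ∀ {Q C} x xs → AverageAtMost w Q C (x ∷ xs) →
                   AverageAtMost w Q C (HeaviestSplit.rest (heaviestSplit x xs))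
    average-rest {Q} {C} x xs avg =
      average-without-max (w heaviest) (weight w rest) (length rest) Q C rest-bounded
        (subst₂ (λ W ℓ → W * Q ≤ C * ℓ) weight-split (sym length-rest) avg)
      where open HeaviestSplit (heaviestSplit x xs)

    record Trimmed (Q C b : ℕ) (xs : List X) : Set a where
      field
        kept         : List X
        kept⊑        : kept ⊑ xs
        kept-length  : length kept ≡ b
        kept-average : AverageAtMost w Q C kept

    trim : ∀ {Q C b} j (xs : List X) → length xs ≡ j + b → AverageAtMost w Q C xs → Trimmed Q C b xs
    trim zero xs len avg = record { kept = xs ; kept⊑ = ⊑-refl ; kept-length = len ; kept-average = avg }
    trim {Q} {C} (suc j) (x ∷ xs) len avg = record
      { kept = kept ; kept⊑ = ⊑-trans kept⊑ rest⊑ ; kept-length = kept-length ; kept-average = kept-average }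
      where
      open HeaviestSplit (heaviestSplit x xs)
      open Trimmed (trim {Q} {C} j rest (suc-injective (trans length-rest len)) (average-rest {Q} {C} x xs avg))

-- Cardinalities and traces of subsets of Fin n.

card-split : ∀ {n} (V X : Subset n) → ∣ V ∣ ≡ ∣ V ∩ X ∣ + ∣ V ∩ ∁ X ∣
card-split Vec.[]            Vec.[]            = refl
card-split (inside  Vec.∷ V) (inside  Vec.∷ X) = cong suc (card-split V X)
card-split (inside  Vec.∷ V) (outside Vec.∷ X) = trans (cong suc (card-split V X)) (sym (+-suc _ _))
card-split (outside Vec.∷ V) (_       Vec.∷ X) = card-split V X

module _ {n : ℕ} where

  member⇒card≥1 : ∀ {p : Subset n} {x : Fin n} → x ∈ p → 1 ≤ ∣ p ∣
  member⇒card≥1 {p} {x} x∈p = subst (_≤ ∣ p ∣) (∣⁅x⁆∣≡1 x)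
    (p⊆q⇒∣p∣≤∣q∣ λ y∈⁅x⁆ → subst (_∈ p) (sym (x∈⁅y⁆⇒x≡y x y∈⁅x⁆)) x∈p)

  ∩-monoʳ-⊆ : ∀ (F : Subset n) {U V} → U ⊆ V → F ∩ U ⊆ F ∩ V
  ∩-monoʳ-⊆ F {U} U⊆V h = let (xF , xU) = x∈p∩q⁻ F U h in x∈p∩q⁺ (xF , U⊆V xU)

  ∈-⋃ : ∀ {F : Subset n} {K : List (Subset n)} {x : Fin n} → F ∈ₗ K → x ∈ F → x ∈ ⋃ K
  ∈-⋃ (here refl) x∈F = x∈p∪q⁺ (inj₁ x∈F)
  ∈-⋃ (there F∈K) x∈F = x∈p∪q⁺ (inj₂ (∈-⋃ F∈K x∈F))

  trace : List (Subset n) → Subset n → ℕ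
  trace K U = weight (λ F → ∣ F ∩ U ∣) K

  trace-mono : ∀ (K : List (Subset n)) {U V} → U ⊆ V → trace K U ≤ trace K V
  trace-mono K U⊆V = weight-mono K (All.tabulate λ {F} _ → p⊆q⇒∣p∣≤∣q∣ (∩-monoʳ-⊆ F U⊆V))

  trace≤totalSize : ∀ (K : List (Subset n)) U → trace K U ≤ totalSize K
  trace≤totalSize K U = weight-mono K (All.tabulate λ {F} _ → ∣p∩q∣≤∣p∣ F U)

  trace≤card : ∀ (K : List (Subset n)) U → AllPairs Disjoint K → trace K U ≤ ∣ U ∣
  trace≤card []      U []              = z≤n
  trace≤card (F ∷ K) U (F#K ∷ K-disj) = begin
    ∣ F ∩ U ∣ + trace K U             ≤⟨ +-monoʳ-≤ ∣ F ∩ U ∣ (weight-mono K (All.map avoidF F#K)) ⟩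
    ∣ F ∩ U ∣ + trace K (U ∩ ∁ F)     ≤⟨ +-monoʳ-≤ ∣ F ∩ U ∣ (trace≤card K (U ∩ ∁ F) K-disj) ⟩
    ∣ F ∩ U ∣ + ∣ U ∩ ∁ F ∣           ≡⟨ cong (λ V → ∣ V ∣ + ∣ U ∩ ∁ F ∣) (∩-comm F U) ⟩
    ∣ U ∩ F ∣ + ∣ U ∩ ∁ F ∣           ≡⟨ card-split U F ⟨
    ∣ U ∣                             ∎
    where
    open ≤-Reasoning
    avoidF : ∀ {G} → Disjoint F G → ∣ G ∩ U ∣ ≤ ∣ G ∩ (U ∩ ∁ F) ∣
    avoidF {G} F#G = p⊆q⇒∣p∣≤∣q∣ λ {x} h → let (xG , xU) = x∈p∩q⁻ G U h in
      x∈p∩q⁺ (xG , x∈p∩q⁺ (xU , x∉p⇒x∈∁p λ xF → F#G (x , x∈p∩q⁺ (xF , xG))))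

  card≤trace : ∀ (K : List (Subset n)) V → V ⊆ ⋃ K → ∣ V ∣ ≤ trace K V
  card≤trace []      V V⊆⋃ = ≤-trans (p⊆q⇒∣p∣≤∣q∣ V⊆⋃) (≤-reflexive (∣⊥∣≡0 n))
  card≤trace (F ∷ K) V V⊆⋃ = begin
    ∣ V ∣                           ≡⟨ card-split V F ⟩
    ∣ V ∩ F ∣ + ∣ V ∩ ∁ F ∣         ≡⟨ cong (λ W → ∣ W ∣ + ∣ V ∩ ∁ F ∣) (∩-comm V F) ⟩
    ∣ F ∩ V ∣ + ∣ V ∩ ∁ F ∣         ≤⟨ +-monoʳ-≤ ∣ F ∩ V ∣ (card≤trace K _ outsideF⊆⋃K) ⟩
    ∣ F ∩ V ∣ + trace K (V ∩ ∁ F)   ≤⟨ +-monoʳ-≤ ∣ F ∩ V ∣ (trace-mono K (p∩q⊆p V (∁ F))) ⟩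
    ∣ F ∩ V ∣ + trace K V           ∎
    where
    open ≤-Reasoning
    outsideF⊆⋃K : V ∩ ∁ F ⊆ ⋃ K
    outsideF⊆⋃K h with x∈p∩q⁻ V (∁ F) h
    ... | xV , x∉F with x∈p∪q⁻ F (⋃ K) (V⊆⋃ xV)
    ...   | inj₁ xF  = ⊥-elim (x∈∁p⇒x∉p x∉F xF)
    ...   | inj₂ x⋃K = x⋃K

  stays-disjoint : ∀ (K : List (Subset n)) {E S} → All (λ F → Disjoint F E) K → S ⊆ ∁ (⋃ K) →
                   All (λ F → Disjoint F (E ∪ S)) K
  stays-disjoint K {E} {S} K#E S#⋃K = All.tabulate λ {F} F∈K (x , h) →
    let (xF , xE∪S) = x∈p∩q⁻ F (E ∪ S) h in
    [ (λ xE → All.lookup K#E F∈K (x , x∈p∩q⁺ (xF , xE)))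
    , (λ xS → x∈∁p⇒x∉p (S#⋃K xS) (∈-⋃ F∈K xF)) ] (x∈p∪q⁻ E S xE∪S)

  outside-large : ∀ (K K' : List (Subset n)) U {q} → AllPairs Disjoint K →
                  q + trace K' U ≤ trace K U → q ≤ ∣ U ∩ ∁ (⋃ K') ∣
  outside-large K K' U {q} K-disj lighter = +-cancelʳ-≤ (trace K' U) q _ (begin
    q + trace K' U                          ≤⟨ lighter ⟩
    trace K U                               ≤⟨ trace≤card K U K-disj ⟩
    ∣ U ∣                                   ≡⟨ card-split U (⋃ K') ⟩
    ∣ U ∩ ⋃ K' ∣ + ∣ U ∩ ∁ (⋃ K') ∣         ≤⟨ +-monoˡ-≤ _ inside≤trace ⟩
    trace K' U + ∣ U ∩ ∁ (⋃ K') ∣           ≡⟨ +-comm (trace K' U) _ ⟩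
    ∣ U ∩ ∁ (⋃ K') ∣ + trace K' U           ∎)
    where
    open ≤-Reasoning
    inside≤trace : ∣ U ∩ ⋃ K' ∣ ≤ trace K' U
    inside≤trace = ≤-trans (card≤trace K' (U ∩ ⋃ K') (p∩q⊆q U (⋃ K'))) (trace-mono K' (p∩q⊆p U (⋃ K')))

module _ {n : ℕ} where

  unclaimed⁻ : ∀ {A E : Subset n} {x} → x ∈ Unclaimed A E → x ∉ A × x ∉ E
  unclaimed⁻ h = (λ xA → x∈∁p⇒x∉p h (x∈p∪q⁺ (inj₁ xA)))
                , (λ xE → x∈∁p⇒x∉p h (x∈p∪q⁺ (inj₂ xE)))

  unclaimed⁺ : ∀ {A E : Subset n} {x} → x ∉ A → x ∉ E → x ∈ Unclaimed A E
  unclaimed⁺ {A} {E} x∉A x∉E = x∉p⇒x∈∁p λ h → [ x∉A , x∉E ] (x∈p∪q⁻ A E h)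

  avoider-claims : ∀ (A E S : Subset n) → Unclaimed (A ∪ S) E ⊆ Unclaimed A E ∩ ∁ S
  avoider-claims A E S h = let (x∉A∪S , x∉E) = unclaimed⁻ h in
    x∈p∩q⁺ ( unclaimed⁺ (λ xA → x∉A∪S (x∈p∪q⁺ (inj₁ xA))) x∉E
           , x∉p⇒x∈∁p λ xS → x∉A∪S (x∈p∪q⁺ (inj₂ xS)))

  enforcer-claims : ∀ (A E S : Subset n) → Unclaimed A (E ∪ S) ⊆ Unclaimed A E ∩ ∁ S
  enforcer-claims A E S h = let (x∉A , x∉E∪S) = unclaimed⁻ h in
    x∈p∩q⁺ ( unclaimed⁺ x∉A (λ xE → x∉E∪S (x∈p∪q⁺ (inj₁ xE)))
           , x∉p⇒x∈∁p λ xS → x∉E∪S (x∈p∪q⁺ (inj₂ xS)))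

  claim-outside : ∀ (A E X : Subset n) → Unclaimed A (E ∪ (Unclaimed A E ∩ ∁ X)) ⊆ Unclaimed A E ∩ X
  claim-outside A E X h = let (xU , x∉S) = x∈p∩q⁻ U _ (enforcer-claims A E (U ∩ ∁ X) h) in
    x∈p∩q⁺ (xU , x∉∁p⇒x∈p λ x∉X → x∈∁p⇒x∉p x∉S (x∈p∩q⁺ (xU , x∉X)))
    where U = Unclaimed A E

  legal-shrinks : ∀ {r} (A E S : Subset n) → LegalMove r (Unclaimed A E) S →
                  ∣ Unclaimed (A ∪ S) E ∣ ≤ ∣ Unclaimed A E ∣ ∸ r
  legal-shrinks {r} A E S (S⊆U , quota) = shrink quota
    where
    U = Unclaimed A E
    U' = Unclaimed (A ∪ S) E
    shrinks-by-S : ∣ U' ∣ ≤ ∣ U ∣ ∸ ∣ S ∣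
    shrinks-by-S = m+n≤o⇒m≤o∸n ∣ U' ∣ (begin
      ∣ U' ∣ + ∣ S ∣               ≤⟨ +-mono-≤ (p⊆q⇒∣p∣≤∣q∣ (avoider-claims A E S))
                                              (p⊆q⇒∣p∣≤∣q∣ λ xS → x∈p∩q⁺ (S⊆U xS , xS)) ⟩
      ∣ U ∩ ∁ S ∣ + ∣ U ∩ S ∣      ≡⟨ +-comm ∣ U ∩ ∁ S ∣ ∣ U ∩ S ∣ ⟩
      ∣ U ∩ S ∣ + ∣ U ∩ ∁ S ∣      ≡⟨ card-split U S ⟨
      ∣ U ∣                        ∎)
      where open ≤-Reasoning
    shrink : (r ≤ ∣ U ∣ × r ≤ ∣ S ∣) ⊎ (∣ U ∣ < r × S ≡ U) → ∣ U' ∣ ≤ ∣ U ∣ ∸ r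
    shrink (inj₁ (_ , r≤S))   = ≤-trans shrinks-by-S (∸-monoʳ-≤ ∣ U ∣ r≤S)
    shrink (inj₂ (_ , refl))  = ≤-trans shrinks-by-S (≤-trans (≤-reflexive (n∸n≡0 ∣ U ∣)) z≤n)

  claim-all : ∀ {r} (U : Subset n) → LegalMove r U U
  claim-all {r} U with r ≤? ∣ U ∣
  ... | yes r≤U = (λ x∈U → x∈U) , inj₁ (r≤U , r≤U)
  ... | no  r≰U = (λ x∈U → x∈U) , inj₂ (≰⇒> r≰U , refl)

  exhausted⊆A : ∀ {F A E : Subset n} → Disjoint F E → Empty (F ∩ Unclaimed A E) → F ⊆ A
  exhausted⊆A {F} {A} {E} F#E F∩U-empty {x} xF with x ∈? A
  ... | yes xA = xA
  ... | no x∉A = ⊥-elim (F∩U-empty (x , x∈p∩q⁺ (xF , unclaimed⁺ x∉A x∉E)))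
    where
    x∉E : x ∉ E
    x∉E xE = F#E (x , x∈p∩q⁺ (xF , xE))

module Game (p q : ℕ) {n : ℕ} (𝓕 : Hypergraph n) where

  EW : Player → Subset n → Subset n → Set
  EW = EnforcerWins p q 𝓕

  avoiderTurn : ∀ {A E} → (Empty (Unclaimed A E) → AvoiderLoses 𝓕 A) →
                (∀ S → LegalMove p (Unclaimed A E) S → EW enforcer (A ∪ S) E) → EW avoider A E
  avoiderTurn {A} {E} stuck moves with nonempty? (Unclaimed A E)
  ... | yes U≠∅ = avMove U≠∅ moves
  ... | no  U=∅ = gameOver U=∅ (stuck U=∅)

  -- Once Avoider has fully claimed an edge, Enforcer wins: on each of his
  -- turns he claims every unclaimed element.
  lostWins : ∀ t {A E} → AvoiderLoses 𝓕 A → EW t A E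
  lostWins enforcer {A} {E} lost with nonempty? (Unclaimed A E)
  ... | no  U=∅ = gameOver U=∅ lost
  ... | yes U≠∅ = enfMove U U≠∅ (claim-all U) (gameOver nothing-left lost)
    where
    U = Unclaimed A E
    nothing-left : Empty (Unclaimed A (E ∪ U))
    nothing-left (x , h) = let (xU , x∉U) = x∈p∩q⁻ U (∁ U) (enforcer-claims A E U h) in x∈∁p⇒x∉p x∉U xU
  lostWins avoider lost = avoiderTurn (λ _ → lost) λ _ _ → lostWins enforcer (keeps-losing lost)
    where
    keeps-losing : ∀ {A S} → AvoiderLoses 𝓕 A → AvoiderLoses 𝓕 (A ∪ S)
    keeps-losing (F , F∈𝓕 , F⊆A) = F , F∈𝓕 , λ xF → x∈p∪q⁺ (inj₁ (F⊆A xF))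

-- A dyadic lower bound for harmonic sums.

sumBelow : (ℕ → ℕ) → ℕ → ℕ
sumBelow g zero    = 0
sumBelow g (suc m) = g m + sumBelow g m

sumBelow-+ : ∀ (g : ℕ → ℕ) a b → sumBelow g (b + a) ≡ sumBelow (λ i → g (a + i)) b + sumBelow g a
sumBelow-+ g a zero    = refl
sumBelow-+ g a (suc b) = trans (cong₂ _+_ (cong g (+-comm b a)) (sumBelow-+ g a b))
                               (sym (+-assoc (g (a + b)) _ _))

sumBelow-mono : ∀ (g h : ℕ → ℕ) m → (∀ i → g i ≤ h i) → sumBelow g m ≤ sumBelow h m
sumBelow-mono g h zero    g≤h = z≤n
sumBelow-mono g h (suc m) g≤h = +-mono-≤ (g≤h m) (sumBelow-mono g h m g≤h)

sumBelow-positive : ∀ (g : ℕ → ℕ) m → (∀ i → i < m → 1 ≤ g i) → m ≤ sumBelow g m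
sumBelow-positive g zero    pos = z≤n
sumBelow-positive g (suc m) pos = +-mono-≤ (pos m ≤-refl) (sumBelow-positive g m λ i i<m → pos i (m<n⇒m<1+n i<m))

sumBelow-double : ∀ (g : ℕ → ℕ) m → sumBelow (λ i → 2 * g i) m ≡ 2 * sumBelow g m
sumBelow-double g zero    = refl
sumBelow-double g (suc m) = trans (cong (2 * g m +_) (sumBelow-double g m)) (sym (*-distribˡ-+ 2 (g m) _))

double-quotient : ∀ x y .{{_ : NonZero y}} → 2 * (x / y) ≤ (2 * x) / y
double-quotient x y = subst (_≤ (2 * x) / y) (m*n/n≡m (2 * (x / y)) y)
  (/-monoˡ-≤ y (subst (_≤ 2 * x) (sym (*-assoc 2 (x / y) y)) (*-monoʳ-≤ 2 (m/n*n≤m x y))))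

-- harmonic L = Σ_{i < 2^L} ⌊2^L / (i + 1)⌋, roughly 2^L · L · ln 2.
harmonic : ℕ → ℕ
harmonic L = sumBelow (λ i → 2 ^ L / suc i) (2 ^ L)

-- The dyadic estimate: the second half of the range contributes at least
-- 2^L, the first half at least twice the previous level.
harmonic-bound : ∀ L → (L + 2) * 2 ^ L ≤ 2 * harmonic L
harmonic-bound zero    = ≤-refl
harmonic-bound (suc L) = begin
    (suc L + 2) * (2 * P)                       ≡⟨ solve 2 (λ l x → (con 1 :+ l :+ con 2) :* (con 2 :* x)
                                                       := con 2 :* x :+ con 2 :* ((l :+ con 2) :* x)) refl L P ⟩
    2 * P + 2 * ((L + 2) * P)                   ≤⟨ +-monoʳ-≤ (2 * P) (*-monoʳ-≤ 2 (harmonic-bound L)) ⟩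
    2 * P + 2 * (2 * harmonic L)                ≡⟨ *-distribˡ-+ 2 P (2 * harmonic L) ⟨
    2 * (P + 2 * harmonic L)                    ≤⟨ *-monoʳ-≤ 2 (+-mono-≤ upper-half lower-half) ⟩
    2 * (sumBelow (λ i → g (P + i)) P + sumBelow g P) ≡⟨ cong (2 *_) (sumBelow-+ g P P) ⟨
    2 * sumBelow g (P + P)                      ≡⟨ cong (λ t → 2 * sumBelow g (P + t)) (+-identityʳ P) ⟨
    2 * harmonic (suc L)                        ∎
  where
  open ≤-Reasoning
  open +-*-Solver
  P = 2 ^ L
  g : ℕ → ℕ
  g i = (2 * P) / suc i
  upper-half : P ≤ sumBelow (λ i → g (P + i)) P
  upper-half = sumBelow-positive (λ i → g (P + i)) P λ i i<P → m≥n⇒m/n>0 (begin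
    suc (P + i)   ≡⟨ +-suc P i ⟨
    P + suc i     ≤⟨ +-monoʳ-≤ P i<P ⟩
    P + P         ≡⟨ cong (P +_) (+-identityʳ P) ⟨
    2 * P         ∎)
  lower-half : 2 * harmonic L ≤ sumBelow g P
  lower-half = subst (_≤ sumBelow g P) (sumBelow-double (λ i → P / suc i) P)
    (sumBelow-mono _ _ P λ i → double-quotient P (suc i))

-- Enforcer's trimming strategy.
--
-- Parameters: the matching M ⊆ 𝓕, a scale Q ≥ 1 for averages, and the
-- amounts d i by which the budget may decrease in round i, which must be
-- covered by Avoider's p claims spread over the q·i + 1 edges of that round.

module Strategy (p q : ℕ) {n : ℕ} (𝓕 : Hypergraph n)
                (M : List (Subset n)) (M⊆𝓕 : All (_∈ₗ 𝓕) M) (M-disjoint : AllPairs Disjoint M)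
                (Q : ℕ) (Q≥1 : 1 ≤ Q)
                (d : ℕ → ℕ) (d-covered : ∀ i → d i * suc (q * i) ≤ p * Q) where

  open Game p q 𝓕

  record LiveFamily (m : ℕ) (E : Subset n) : Set where
    field
      edges   : List (Subset n)
      edges⊑M : edges ⊑ M
      live    : All (λ F → Disjoint F E) edges
      size    : length edges ≡ suc (q * m)

  open LiveFamily

  record EnforcerInvariant (m C : ℕ) (A E : Subset n) : Set where
    field
      family  : LiveFamily m E
      average : AverageAtMost (λ F → ∣ F ∩ Unclaimed A E ∣) Q C (edges family)

  -- With Avoider to move: the edges cover the unclaimed set, and after
  -- Avoider's p claims the average will be at most C / Q.
  record AvoiderInvariant (m C : ℕ) (A E : Subset n) : Set where
    field
      family  : LiveFamily m E
      covers  : Unclaimed A E ⊆ ⋃ (edges family)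
      average : (trace (edges family) (Unclaimed A E) ∸ p) * Q ≤ C * length (edges family)

  firstEdge : ∀ {m E} (K : LiveFamily m E) → Σ (Subset n) (_∈ₗ edges K)
  firstEdge K with edges K | size K
  ... | F ∷ _ | _ = F , here refl

  exhaustedLoses : ∀ {m A E F} (K : LiveFamily m E) → F ∈ₗ edges K →
                   Empty (F ∩ Unclaimed A E) → AvoiderLoses 𝓕 A
  exhaustedLoses {F = F} K F∈K exhausted =
    F , All.lookup M⊆𝓕 (Any-resp-⊆ (edges⊑M K) F∈K) , exhausted⊆A (All.lookup (live K) F∈K) exhausted

  nothingLeftLoses : ∀ {m A E} (K : LiveFamily m E) → Empty (Unclaimed A E) → AvoiderLoses 𝓕 A
  nothingLeftLoses K U=∅ = let (F , F∈K) = firstEdge K in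
    exhaustedLoses K F∈K λ (x , h) → U=∅ (x , p∩q⊆q F _ h)

  lostOrAlive : ∀ {m A E} (K : LiveFamily m E) →
                AvoiderLoses 𝓕 A ⊎ All (λ F → Nonempty (F ∩ Unclaimed A E)) (edges K)
  lostOrAlive {A = A} {E} K with all? (λ F → nonempty? (F ∩ Unclaimed A E)) (edges K)
  ... | yes alive = inj₂ alive
  ... | no ¬alive =
    let (F , F∈K , exhausted) = find (¬All⇒Any¬ (λ F → nonempty? (F ∩ Unclaimed A E)) _ ¬alive)
    in inj₁ (exhaustedLoses K F∈K exhausted)

  -- Enforcer's move in round m + 1: drop the q edges meeting the unclaimed
  -- set U most often and claim U outside the remaining edges.
  enforcerStep : ∀ {m C A E} (inv : EnforcerInvariant (suc m) C A E) →
    All (λ F → Nonempty (F ∩ Unclaimed A E)) (edges (EnforcerInvariant.family inv)) →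
    Σ (Subset n) λ S → LegalMove q (Unclaimed A E) S × AvoiderInvariant m (C ∸ d m) A (E ∪ S)
  enforcerStep {m} {C} {A} {E} inv alive = S , legal , record { family = family' ; covers = covers' ; average = average' }
    where
    open EnforcerInvariant inv
    K = edges family
    U = Unclaimed A E
    w : Subset n → ℕ
    w F = ∣ F ∩ U ∣
    size' : length K ≡ q + suc (q * m)
    size' = trans (size family) (trans (cong suc (*-suc q m)) (sym (+-suc q (q * m))))
    open Trimmed (trim w {Q} {C} q K size' average)
    S = U ∩ ∁ (⋃ kept)
    lighter : q + trace kept U ≤ trace K U
    lighter = dropped-weight w q kept⊑ (All.map (λ (x , h) → member⇒card≥1 h) alive)
                (trans size' (cong (q +_) (sym kept-length)))
    legal : LegalMove q U S
    legal = p∩q⊆p U _ , inj₁ (≤-trans enough (p⊆q⇒∣p∣≤∣q∣ (p∩q⊆p U _)) , enough)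
      where enough = outside-large K kept U (AllPairs-⊑ (edges⊑M family) M-disjoint) lighter
    U₁ = Unclaimed A (E ∪ S)
    U₁⊆U : U₁ ⊆ U
    U₁⊆U h = proj₁ (x∈p∩q⁻ U _ (claim-outside A E (⋃ kept) h))
    covers' : U₁ ⊆ ⋃ kept
    covers' h = proj₂ (x∈p∩q⁻ U _ (claim-outside A E (⋃ kept) h))
    family' : LiveFamily m (E ∪ S)
    family' = record
      { edges = kept ; edges⊑M = ⊑-trans kept⊑ (edges⊑M family) ; size = kept-length
      ; live = stays-disjoint kept (All-resp-⊆ kept⊑ (live family)) (p∩q⊆q U _) }
    average' : (trace kept U₁ ∸ p) * Q ≤ (C ∸ d m) * length kept
    average' = begin
      (trace kept U₁ ∸ p) * Q   ≤⟨ *-monoˡ-≤ Q (∸-monoˡ-≤ p (trace-mono kept U₁⊆U)) ⟩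
      (trace kept U ∸ p) * Q    ≤⟨ pay (trace kept U) Q C (d m) p (length kept) kept-average cost ⟩
      (C ∸ d m) * length kept   ∎
      where
      open ≤-Reasoning
      cost : d m * length kept ≤ p * Q
      cost = subst (λ b → d m * b ≤ p * Q) (sym kept-length) (d-covered m)

  -- Avoider's move: his p claims lie in ⋃ K, so they lower the trace by p.
  avoiderStep : ∀ {m C A E S} (inv : AvoiderInvariant m C A E) →
    LegalMove p (Unclaimed A E) S → EnforcerInvariant m C (A ∪ S) E
  avoiderStep {A = A} {E} {S} inv legal = record
    { family = family ; average = ≤-trans (*-monoˡ-≤ Q trace-drops) average }
    where
    open AvoiderInvariant inv
    K = edges family
    trace-drops : trace K (Unclaimed (A ∪ S) E) ≤ trace K (Unclaimed A E) ∸ p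
    trace-drops = begin
      trace K (Unclaimed (A ∪ S) E)  ≤⟨ trace≤card K _ (AllPairs-⊑ (edges⊑M family) M-disjoint) ⟩
      ∣ Unclaimed (A ∪ S) E ∣        ≤⟨ legal-shrinks A E S legal ⟩
      ∣ Unclaimed A E ∣ ∸ p          ≤⟨ ∸-monoˡ-≤ p (card≤trace K _ covers) ⟩
      trace K (Unclaimed A E) ∸ p    ∎
      where open ≤-Reasoning

  finalRound : ∀ {C A E} (inv : EnforcerInvariant 0 C A E) →
    All (λ F → Nonempty (F ∩ Unclaimed A E)) (edges (EnforcerInvariant.family inv)) → Q ≤ C
  finalRound {C} {A} {E} inv alive = begin
    Q                            ≡⟨ *-identityˡ Q ⟨
    1 * Q                        ≡⟨ cong (_* Q) one-edge ⟨
    length K * Q                 ≤⟨ *-monoˡ-≤ Q (length≤weight w K positive) ⟩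
    trace K (Unclaimed A E) * Q  ≤⟨ average ⟩
    C * length K                 ≡⟨ cong (C *_) one-edge ⟩
    C * 1                        ≡⟨ *-identityʳ C ⟩
    C                            ∎
    where
    open ≤-Reasoning
    open EnforcerInvariant inv
    K = edges family
    w : Subset n → ℕ
    w F = ∣ F ∩ Unclaimed A E ∣
    one-edge : length K ≡ 1
    one-edge = trans (size family) (cong suc (*-zeroʳ q))
    positive : All (λ F → 1 ≤ w F) K
    positive = All.map (λ (x , h) → member⇒card≥1 h) alive

  -- The strategy wins while the budget C stays below Q plus what the
  -- remaining rounds may spend.
  mutual
    enforcerWins : ∀ m {C A E} → C < Q + sumBelow d m → EnforcerInvariant m C A E → EW enforcer A E
    enforcerWins m budget inv with lostOrAlive (EnforcerInvariant.family inv)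
    ... | inj₁ lost = lostWins enforcer lost
    enforcerWins zero {C} budget inv | inj₂ alive =
      ⊥-elim (<⇒≱ budget (subst (_≤ C) (sym (+-identityʳ Q)) (finalRound inv alive)))
    enforcerWins (suc m) {C} {A} {E} budget inv | inj₂ alive =
      let (S , legal , next) = enforcerStep inv alive in
      enfMove S U≠∅ legal (avoiderWins m (spend C (d m) (sumBelow d m) Q≥1 budget) next)
      where
      open EnforcerInvariant inv
      U≠∅ : Nonempty (Unclaimed A E)
      U≠∅ = let (F , F∈K) = firstEdge family ; (x , h) = All.lookup alive F∈K in x , p∩q⊆q F _ h

    avoiderWins : ∀ m {C A E} → C < Q + sumBelow d m → AvoiderInvariant m C A E → EW avoider A E
    avoiderWins m budget inv =
      avoiderTurn (nothingLeftLoses (AvoiderInvariant.family inv)) λ S legal →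
        enforcerWins m budget (avoiderStep inv legal)

  -- At the start M itself is the family, and its average trace is bounded
  -- by its average edge size.
  enforcerWinsGame : ∀ m C → length M ≡ suc (q * m) → AverageAtMost ∣_∣ Q C M →
    C < Q + sumBelow d m → EW avoider ∅ₛ ∅ₛ × EW enforcer ∅ₛ ∅ₛ
  enforcerWinsGame m C size-M average-M budget =
    avoiderTurn (nothingLeftLoses M-family) (λ S _ → enforcerWins m budget (initial (∅ₛ ∪ S))) ,
    enforcerWins m budget (initial ∅ₛ)
    where
    M-family : LiveFamily m ∅ₛ
    M-family = record { edges = M ; edges⊑M = ⊑-refl ; size = size-M
                      ; live = All.tabulate λ {F} _ (x , h) → ∉⊥ (proj₂ (x∈p∩q⁻ F ∅ₛ h)) }
    initial : ∀ A → EnforcerInvariant m C A ∅ₛ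
    initial A = record { family = M-family
                       ; average = ≤-trans (*-monoˡ-≤ Q (trace≤totalSize M (Unclaimed A ∅ₛ))) average-M }

-- For average edge size at most k = k₀ + 1 take
-- P = 2 ^ (2·k₀·q) rounds, a matching of size N = q·P + 1, scale Q = q·P,
-- initial budget k·Q, and let round i spend d i = ⌊P / (i + 1)⌋.

spending-covered : ∀ p q P i → 1 ≤ p → 1 ≤ q → (P / suc i) * suc (q * i) ≤ p * (q * P)
spending-covered p q P i p≥1 q≥1 = begin
  d * suc (q * i)     ≤⟨ *-monoʳ-≤ d (+-monoˡ-≤ (q * i) q≥1) ⟩
  d * (q + q * i)     ≡⟨ cong (d *_) (*-suc q i) ⟨
  d * (q * suc i)     ≡⟨ solve 3 (λ a b c → a :* (b :* c) := b :* (a :* c)) refl d q (suc i) ⟩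
  q * (d * suc i)     ≤⟨ *-monoʳ-≤ q (m/n*n≤m P (suc i)) ⟩
  q * P               ≤⟨ m≤n*m (q * P) p {{>-nonZero p≥1}} ⟩
  p * (q * P)         ∎
  where
  open ≤-Reasoning
  open +-*-Solver
  d = P / suc i

-- The harmonic sum exceeds the initial budget: k·Q < Q + Σ_{i<P} d i.
budget-suffices : ∀ q k₀ → let P = 2 ^ (2 * (k₀ * q)) in
                  suc k₀ * (q * P) < q * P + harmonic (2 * (k₀ * q))
budget-suffices q k₀ = +-monoʳ-< (q * P) (begin-strict
  k₀ * (q * P)          <⟨ m<m+n (k₀ * (q * P)) (m^n>0 2 L) ⟩
  k₀ * (q * P) + P      ≤⟨ *-cancelˡ-≤ 2 (begin
      2 * (k₀ * (q * P) + P)   ≡⟨ solve 3 (λ a b x → con 2 :* (a :* (b :* x) :+ x)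
                                               := (con 2 :* (a :* b) :+ con 2) :* x) refl k₀ q P ⟩
      (L + 2) * P              ≤⟨ harmonic-bound L ⟩
      2 * harmonic L           ∎) ⟩
  harmonic L            ∎)
  where
  open ≤-Reasoning
  open +-*-Solver
  L = 2 * (k₀ * q)
  P = 2 ^ L

-- Rescaling: average size at most k means average at most (k·Q) / Q.
scaled-average : ∀ t k N Q → t ≤ k * N → t * Q ≤ k * Q * N
scaled-average t k N Q t≤kN = begin
  t * Q       ≤⟨ *-monoˡ-≤ Q t≤kN ⟩
  k * N * Q   ≡⟨ solve 3 (λ a b c → a :* b :* c := a :* c :* b) refl k N Q ⟩
  k * Q * N   ∎
  where
  open ≤-Reasoning
  open +-*-Solver

corollary1p8 : (p q : ℕ) → 1 ≤ p → 1 ≤ q → (k : ℕ) → 1 ≤ k →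
    Σ ℕ λ N → 1 ≤ N ×
      (∀ (n : ℕ) (𝓕 : Hypergraph n) (M : List (Subset n)) →
        IsMatching 𝓕 M → length M ≡ N → totalSize M ≤ k * N →
        EnforcerWins p q 𝓕 avoider ∅ₛ ∅ₛ × EnforcerWins p q 𝓕 enforcer ∅ₛ ∅ₛ)
corollary1p8 p q p≥1 q≥1 (suc k₀) _ = suc Q , s≤s z≤n , wins
  where
  L = 2 * (k₀ * q)
  P = 2 ^ L
  Q = q * P
  wins : ∀ (n : ℕ) (𝓕 : Hypergraph n) (M : List (Subset n)) →
    IsMatching 𝓕 M → length M ≡ suc Q → totalSize M ≤ suc k₀ * suc Q →
    EnforcerWins p q 𝓕 avoider ∅ₛ ∅ₛ × EnforcerWins p q 𝓕 enforcer ∅ₛ ∅ₛ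
  wins n 𝓕 M (M⊆𝓕 , _ , M-disjoint) size-M small-M =
    Strategy.enforcerWinsGame p q 𝓕 M M⊆𝓕 M-disjoint Q (*-mono-≤ q≥1 (m^n>0 2 L))
      (λ i → P / suc i) (λ i → spending-covered p q P i p≥1 q≥1)
      P (suc k₀ * Q) size-M
      (subst (λ N → totalSize M * Q ≤ suc k₀ * Q * N) (sym size-M)
             (scaled-average _ (suc k₀) (suc Q) Q small-M))
      (budget-suffices q k₀)
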